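{- For every graph $G$ and all $x,y,v\in V(G)$, $x\equiv_G y$ if and only if $x\equiv_{G*v} y$. In other words, the equivalence classes of $(V(G),\equiv_G)$ coincide with those of $(V(G),\equiv_{G*v})$.
   Context: Graphs are finite and simple. $\rho_G(X)$ is the binary rank of the $X\times(V(G)\setminus X)$ adjacency submatrix. $x\equiv_G y$ means $\rho_G(\{x\})=\rho_G(\{y\})\ge\rho_G(\{x,y\})$. $G*v$ is obtained from $G$ by local complementation at $v$, i.e., complementing the adjacency between every pair of neighbors of $v$. -}

module Defs where

open import Data.Nat using (ℕ; zero; suc; _≤_)
open import Data.Bool using (Bool; true; false; _∧_; _xor_; not)
open import Data.Fin using (Fin; zero; suc; _≟_)
open import Data.Fin.Subset using (Subset; _∈_; _∉_; _⊆_; Nonempty; ∣_∣; ⁅_⁆; _∪_)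
open import Data.Vec using (lookup)
open import Data.Product using (Σ; ∃; _×_; _,_)
open import Relation.Binary.PropositionalEquality using (_≡_)
open import Relation.Nullary.Decidable using (⌊_⌋)

AdjMatrix : ℕ → Set
AdjMatrix n = Fin n → Fin n → Bool

IsSimpleGraph : ∀ {n} → AdjMatrix n → Set
IsSimpleGraph {n} A = (∀ (a b : Fin n) → A a b ≡ A b a) × (∀ (a : Fin n) → A a a ≡ false)

localComp : ∀ {n} → AdjMatrix n → Fin n → AdjMatrix n
localComp A v a b = A a b xor (not ⌊ a ≟ b ⌋ ∧ (A v a ∧ A v b))

parity : ∀ {n} → (Fin n → Bool) → Bool
parity {zero} f = false
parity {suc n} f = f zero xor parity (λ i → f (suc i))

-- A set S ⊆ X of rows of the X × (V ∖ X) adjacency submatrix is linearly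
-- independent over GF(2): no nonempty subset T ⊆ S of rows sums to the zero
-- vector (indexed by the columns c ∉ X).
IndependentRows : ∀ {n} → AdjMatrix n → Subset n → Subset n → Set
IndependentRows {n} A X S =
  S ⊆ X ×
  (∀ (T : Subset n) → T ⊆ S → Nonempty T →
     Σ (Fin n) λ c → c ∉ X × parity (λ i → lookup T i ∧ A i c) ≡ true)

-- ρ_G(X) = r : the binary (GF(2)) rank of the X × (V ∖ X) adjacency submatrix
-- is r, i.e. r is the maximum number of linearly independent rows.
CutRank : ∀ {n} → AdjMatrix n → Subset n → ℕ → Set
CutRank {n} A X r =
  (Σ (Subset n) λ S → IndependentRows A X S × ∣ S ∣ ≡ r) ×
  (∀ (S : Subset n) → IndependentRows A X S → ∣ S ∣ ≤ r)

Equiv : ∀ {n} → AdjMatrix n → Fin n → Fin n → Set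
Equiv A x y =
  Σ ℕ λ r → Σ ℕ λ t →
    CutRank A ⁅ x ⁆ r × CutRank A ⁅ y ⁆ r × CutRank A (⁅ x ⁆ ∪ ⁅ y ⁆) t × t ≤ r

-- Local complementation at v acts on the cut matrix of X (rows X, columns V ∖ X)
-- by elementary operations over GF(2). If v ∉ X, column v is added to every column c
-- with A v c = 1; such column operations preserve all linear dependencies among rows.
-- If v ∈ X, row v is added to every row i with A v i = 1. Independent row sets that
-- contain v stay independent; one that does not either stays independent or has a
-- row exchangeable for v. Hence every cut rank ρ(X) is preserved, and so is ≡.
module Submission where

open import Defs
open import Algebra.Bundles using (CommutativeRing)
open import Data.Bool using (Bool; true; false; _∧_; _xor_)
import Data.Bool as Bool
open import Data.Bool.Properties
  using (∧-assoc; ∧-zeroʳ; ∧-distribˡ-xor; ∧-distribʳ-xor; xor-assoc; xor-same; xor-identityʳ; ¬-not; xor-∧-commutativeRing)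
open import Data.Empty using (⊥-elim)
open import Data.Fin using (Fin; zero; suc; _≟_)
open import Data.Fin.Properties using (any?)
open import Data.Fin.Subset using (Subset; inside; outside; _∈_; _∉_; _⊆_; Nonempty; ∣_∣; ⁅_⁆; ⊥)
open import Data.Fin.Subset.Properties
  using (_∈?_; _⊆?_; nonempty?; anySubset?; ⊆-trans; x∈⁅x⁆; x∈⁅y⁆⇒x≡y; x≢y⇒x∉⁅y⁆)
open import Data.Nat using (ℕ; suc; _≤_)
open import Data.Product using (∃; _×_; _,_; proj₁; proj₂)
open import Data.Sum using (_⊎_; inj₁; inj₂)
open import Data.Vec using ([]; _∷_; lookup; zipWith; _[_]≔_; here; there)
open import Data.Vec.Properties using ([]=-injective; []=⇒lookup; lookup⇒[]=; lookup-zipWith; lookup∘update′; []≔-updates)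
open import Function.Bundles using (_⇔_; mk⇔; Equivalence)
open import Relation.Nullary using (¬_; Dec; yes; no)
open import Relation.Nullary.Decidable using (_×-dec_; ¬?; decidable-stable)
open import Relation.Binary.PropositionalEquality
  using (_≡_; _≢_; refl; sym; trans; cong; cong₂; subst; module ≡-Reasoning)
open import Algebra.Properties.CommutativeSemigroup
  (CommutativeRing.+-commutativeSemigroup xor-∧-commutativeRing)
  using () renaming (interchange to xor-interchange)

private
  variable
    n : ℕ
    i j c u v : Fin n
    p q S T U X : Subset n
    B B' : AdjMatrix n

xor-moveʳ : ∀ {x y z} → x ≡ y xor z → y ≡ x xor z
xor-moveʳ {y = y} {z} refl = sym (begin
  (y xor z) xor z  ≡⟨ xor-assoc y z z ⟩
  y xor (z xor z)  ≡⟨ cong (y xor_) (xor-same z) ⟩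
  y xor false      ≡⟨ xor-identityʳ y ⟩
  y                ∎)
  where open ≡-Reasoning

∈⇒lookup : i ∈ p → lookup p i ≡ true
∈⇒lookup = []=⇒lookup

lookup⇒∈ : lookup p i ≡ true → i ∈ p
lookup⇒∈ = lookup⇒[]= _ _

∉⇒lookup : i ∉ p → lookup p i ≡ false
∉⇒lookup i∉p = ¬-not (λ e → i∉p (lookup⇒∈ e))

lookup⇒∉ : lookup p i ≡ false → i ∉ p
lookup⇒∉ eq i∈p with trans (sym (∈⇒lookup i∈p)) eq
... | ()

∈-update-outside⁻ : i ∈ p [ j ]≔ outside → i ∈ p
∈-update-outside⁻ {i = i} {p = p} {j = j} i∈ with i ≟ j
... | yes refl = ⊥-elim (lookup⇒∉ ([]=⇒lookup ([]≔-updates p i)) i∈)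
... | no i≢j   = lookup⇒∈ (trans (sym (lookup∘update′ i≢j p outside)) (∈⇒lookup i∈))

∈-update-inside⁻ : i ∈ p [ j ]≔ inside → i ≢ j → i ∈ p
∈-update-inside⁻ {p = p} i∈ i≢j = lookup⇒∈ (trans (sym (lookup∘update′ i≢j p inside)) (∈⇒lookup i∈))

∣p[i]≔inside∣≡suc∣p∣ : i ∉ p → ∣ p [ i ]≔ inside ∣ ≡ suc ∣ p ∣
∣p[i]≔inside∣≡suc∣p∣ {i = zero}  {p = outside ∷ p} i∉p = refl
∣p[i]≔inside∣≡suc∣p∣ {i = zero}  {p = inside ∷ p}  i∉p = ⊥-elim (i∉p here)
∣p[i]≔inside∣≡suc∣p∣ {i = suc i} {p = outside ∷ p} i∉p = ∣p[i]≔inside∣≡suc∣p∣ (λ i∈ → i∉p (there i∈))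
∣p[i]≔inside∣≡suc∣p∣ {i = suc i} {p = inside ∷ p}  i∉p = cong suc (∣p[i]≔inside∣≡suc∣p∣ (λ i∈ → i∉p (there i∈)))

suc∣p[i]≔outside∣≡∣p∣ : i ∈ p → suc ∣ p [ i ]≔ outside ∣ ≡ ∣ p ∣
suc∣p[i]≔outside∣≡∣p∣ {p = inside ∷ p}  here = refl
suc∣p[i]≔outside∣≡∣p∣ {p = inside ∷ p}  (there i∈p) = cong suc (suc∣p[i]≔outside∣≡∣p∣ i∈p)
suc∣p[i]≔outside∣≡∣p∣ {p = outside ∷ p} (there i∈p) = suc∣p[i]≔outside∣≡∣p∣ i∈p

infixl 7 _⊕_
_⊕_ : Subset n → Subset n → Subset n
_⊕_ = zipWith _xor_

∈-⊕⁻ : i ∈ p ⊕ q → (i ∈ p × i ∉ q) ⊎ (i ∉ p × i ∈ q)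
∈-⊕⁻ {i = i} {p = p} {q = q} i∈
  with lookup p i in ep | lookup q i in eq | trans (sym (lookup-zipWith _xor_ i p q)) (∈⇒lookup i∈)
... | true  | false | _ = inj₁ (lookup⇒∈ ep , lookup⇒∉ eq)
... | false | true  | _ = inj₂ (lookup⇒∉ ep , lookup⇒∈ eq)

∈-⊕⁺ : (i ∈ p × i ∉ q) ⊎ (i ∉ p × i ∈ q) → i ∈ p ⊕ q
∈-⊕⁺ {i = i} {p = p} {q = q} i∈ = lookup⇒∈ (trans (lookup-zipWith _xor_ i p q) (values i∈))
  where
  values : (i ∈ p × i ∉ q) ⊎ (i ∉ p × i ∈ q) → lookup p i xor lookup q i ≡ true
  values (inj₁ (i∈p , i∉q)) = cong₂ _xor_ (∈⇒lookup i∈p) (∉⇒lookup i∉q)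
  values (inj₂ (i∉p , i∈q)) = cong₂ _xor_ (∉⇒lookup i∉p) (∈⇒lookup i∈q)

-- The GF(2) inner product of T's indicator vector with f; in particular T · col B c
-- is entry c of the sum of the rows of B indexed by T.
infix 8 _·_
_·_ : Subset n → (Fin n → Bool) → Bool
T · f = parity (λ i → lookup T i ∧ f i)

·-cong : ∀ {f g} → (∀ {i} → i ∈ T → f i ≡ g i) → T · f ≡ T · g
·-cong {T = []} f≗g = refl
·-cong {T = inside ∷ T}  f≗g = cong₂ _xor_ (f≗g here) (·-cong (λ i∈ → f≗g (there i∈)))
·-cong {T = outside ∷ T} f≗g = ·-cong (λ i∈ → f≗g (there i∈))

⊥-· : ∀ n f → ⊥ {n} · f ≡ false
⊥-· 0 f = refl
⊥-· (suc n) f = ⊥-· n (λ i → f (suc i))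

⁅⁆-· : ∀ (v : Fin n) f → ⁅ v ⁆ · f ≡ f v
⁅⁆-· {suc n} zero f = trans (cong (f zero xor_) (⊥-· n (λ i → f (suc i)))) (xor-identityʳ (f zero))
⁅⁆-· (suc v) f = ⁅⁆-· v (λ i → f (suc i))

⊕-· : ∀ (p q : Subset n) f → (p ⊕ q) · f ≡ p · f xor q · f
⊕-· [] [] f = refl
⊕-· (x ∷ p) (y ∷ q) f = begin
  (x xor y) ∧ f zero xor (p ⊕ q) · f′                    ≡⟨ cong₂ _xor_ (∧-distribʳ-xor (f zero) x y) (⊕-· p q f′) ⟩
  (x ∧ f zero xor y ∧ f zero) xor (p · f′ xor q · f′)    ≡⟨ xor-interchange (x ∧ f zero) (y ∧ f zero) (p · f′) (q · f′) ⟩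
  (x ∧ f zero xor p · f′) xor (y ∧ f zero xor q · f′)    ∎
  where
  open ≡-Reasoning
  f′ = λ i → f (suc i)

⊕⁅⁆-· : ∀ (p : Subset n) v f → (p ⊕ ⁅ v ⁆) · f ≡ p · f xor f v
⊕⁅⁆-· p v f = trans (⊕-· p ⁅ v ⁆ f) (cong (p · f xor_) (⁅⁆-· v f))

·-xor : ∀ (T : Subset n) f g → T · (λ i → f i xor g i) ≡ T · f xor T · g
·-xor [] f g = refl
·-xor (x ∷ T) f g = begin
  x ∧ (f zero xor g zero) xor T · (λ i → f′ i xor g′ i)  ≡⟨ cong₂ _xor_ (∧-distribˡ-xor x (f zero) (g zero)) (·-xor T f′ g′) ⟩
  (x ∧ f zero xor x ∧ g zero) xor (T · f′ xor T · g′)    ≡⟨ xor-interchange (x ∧ f zero) (x ∧ g zero) (T · f′) (T · g′) ⟩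
  (x ∧ f zero xor T · f′) xor (x ∧ g zero xor T · g′)    ∎
  where
  open ≡-Reasoning
  f′ = λ i → f (suc i)
  g′ = λ i → g (suc i)

·-∧ʳ : ∀ (T : Subset n) f b → T · (λ i → f i ∧ b) ≡ T · f ∧ b
·-∧ʳ [] f b = refl
·-∧ʳ (x ∷ T) f b = begin
  x ∧ (f zero ∧ b) xor T · (λ i → f′ i ∧ b)  ≡⟨ cong₂ _xor_ (sym (∧-assoc x (f zero) b)) (·-∧ʳ T f′ b) ⟩
  (x ∧ f zero) ∧ b xor T · f′ ∧ b            ≡⟨ sym (∧-distribʳ-xor b (x ∧ f zero) (T · f′)) ⟩
  (x ∧ f zero xor T · f′) ∧ b                ∎
  where
  open ≡-Reasoning
  f′ = λ i → f (suc i)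

·≡true⇒Nonempty : ∀ (T : Subset n) f → T · f ≡ true → Nonempty T
·≡true⇒Nonempty (inside ∷ T) f sum with f zero
... | true  = zero , here
... | false = let i , i∈T = ·≡true⇒Nonempty T (λ i → f (suc i)) sum in suc i , there i∈T
·≡true⇒Nonempty (outside ∷ T) f sum =
  let i , i∈T = ·≡true⇒Nonempty T (λ i → f (suc i)) sum in suc i , there i∈T

col : AdjMatrix n → Fin n → Fin n → Bool
col B c i = B i c

NonzeroOnCut : AdjMatrix n → Subset n → Subset n → Set
NonzeroOnCut {n} B X T = ∃ λ (c : Fin n) → c ∉ X × T · col B c ≡ true

record ZeroOnCut (B : AdjMatrix n) (X T : Subset n) : Set where
  constructor zeroOnCut
  field sum≡false : ∀ {c} → c ∉ X → T · col B c ≡ false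
open ZeroOnCut

nonzeroOnCut? : ∀ (B : AdjMatrix n) X T → Dec (NonzeroOnCut B X T)
nonzeroOnCut? B X T = any? (λ c → ¬? (c ∈? X) ×-dec (T · col B c Bool.≟ true))

¬nonzero⇒zero : ¬ NonzeroOnCut B X T → ZeroOnCut B X T
¬nonzero⇒zero ¬nonzero = zeroOnCut λ c∉X → ¬-not (λ sum → ¬nonzero (_ , c∉X , sum))

nonzero⇒¬zero : NonzeroOnCut B X T → ¬ ZeroOnCut B X T
nonzero⇒¬zero (c , c∉X , sum) T-zero with trans (sym sum) (sum≡false T-zero c∉X)
... | ()

⊕-zero : ZeroOnCut B X p → ZeroOnCut B X q → ZeroOnCut B X (p ⊕ q)
⊕-zero {B = B} {p = p} {q = q} p-zero q-zero = zeroOnCut λ {c} c∉X →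
  trans (⊕-· p q (col B c)) (cong₂ _xor_ (sum≡false p-zero c∉X) (sum≡false q-zero c∉X))

independent-or-zeroSubset : ∀ (B : AdjMatrix n) X S →
  (∀ T → T ⊆ S → Nonempty T → NonzeroOnCut B X T) ⊎ (∃ λ U → U ⊆ S × Nonempty U × ZeroOnCut B X U)
independent-or-zeroSubset B X S with anySubset? (λ U → U ⊆? S ×-dec nonempty? U ×-dec ¬? (nonzeroOnCut? B X U))
... | yes (U , U⊆S , U≢∅ , ¬nonzero) = inj₂ (U , U⊆S , U≢∅ , ¬nonzero⇒zero ¬nonzero)
... | no ∄zero = inj₁ λ T T⊆S T≢∅ →
  decidable-stable (nonzeroOnCut? B X T) (λ ¬nonzero → ∄zero (T , T⊆S , T≢∅ , ¬nonzero))

replace : Fin n → Fin n → Subset n → Subset n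
replace u v S = S [ u ]≔ outside [ v ]≔ inside

v∈replace : ∀ (S : Subset n) → v ∈ replace u v S
v∈replace {v = v} {u = u} S = []≔-updates (S [ u ]≔ outside) v

∈-replace⁻ : i ∈ replace u v S → i ≢ v → i ∈ S
∈-replace⁻ i∈ i≢v = ∈-update-outside⁻ (∈-update-inside⁻ i∈ i≢v)

u∉replace : u ≢ v → u ∉ replace u v S
u∉replace {u = u} {S = S} u≢v u∈ with []=-injective ([]≔-updates S u) (∈-update-inside⁻ u∈ u≢v)
... | ()

∣replace∣ : u ∈ S → v ∉ S → ∣ replace u v S ∣ ≡ ∣ S ∣
∣replace∣ u∈S v∉S =
  trans (∣p[i]≔inside∣≡suc∣p∣ (λ v∈ → v∉S (∈-update-outside⁻ v∈))) (suc∣p[i]≔outside∣≡∣p∣ u∈S)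

replace-independent : IndependentRows B X S → v ∈ X → v ∉ S → U ⊆ S → u ∈ U →
  ZeroOnCut B X (U ⊕ ⁅ v ⁆) → IndependentRows B X (replace u v S)
replace-independent {B = B} {X = X} {S = S} {v = v} {U = U} {u = u}
  (S⊆X , S-indep) v∈X v∉S U⊆S u∈U U+v-zero = S'⊆X , S'-indep
  where
  S' = replace u v S

  S'⊆X : S' ⊆ X
  S'⊆X {i} i∈ with i ≟ v
  ... | yes refl = v∈X
  ... | no i≢v = S⊆X (∈-replace⁻ i∈ i≢v)

  u∉S' : u ∉ S'
  u∉S' = u∉replace (λ { refl → v∉S (U⊆S u∈U) })

  v∈U+v : v ∈ U ⊕ ⁅ v ⁆
  v∈U+v = ∈-⊕⁺ (inj₂ ((λ v∈U → v∉S (U⊆S v∈U)) , x∈⁅x⁆ v))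

  S'-indep : ∀ T → T ⊆ S' → Nonempty T → NonzeroOnCut B X T
  S'-indep T T⊆S' T≢∅ with v ∈? T
  ... | no v∉T = S-indep T (λ i∈T → ∈-replace⁻ (T⊆S' i∈T) (λ { refl → v∉T i∈T })) T≢∅
  ... | yes v∈T with nonzeroOnCut? B X T
  ...   | yes T-nonzero = T-nonzero
  ...   | no ¬T-nonzero =  -- W is then a zero combination of rows of S containing u
    ⊥-elim (nonzero⇒¬zero (S-indep W W⊆S (u , u∈W)) (⊕-zero {p = T} (¬nonzero⇒zero ¬T-nonzero) U+v-zero))
    where
    W = T ⊕ (U ⊕ ⁅ v ⁆)

    W⊆S : W ⊆ S
    W⊆S i∈W with ∈-⊕⁻ i∈W
    ... | inj₁ (i∈T , i∉U+v) = ∈-replace⁻ (T⊆S' i∈T) (λ { refl → i∉U+v v∈U+v })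
    ... | inj₂ (i∉T , i∈U+v) with ∈-⊕⁻ i∈U+v
    ...   | inj₁ (i∈U , _) = U⊆S i∈U
    ...   | inj₂ (_ , i∈⁅v⁆) = ⊥-elim (i∉T (subst (_∈ T) (sym (x∈⁅y⁆⇒x≡y v i∈⁅v⁆)) v∈T))

    u∈W : u ∈ W
    u∈W = ∈-⊕⁺ (inj₂ ((λ u∈T → u∉S' (T⊆S' u∈T)) ,
                       ∈-⊕⁺ (inj₁ (u∈U , x≢y⇒x∉⁅y⁆ (λ { refl → v∉S (U⊆S u∈U) })))))

IndependentRowsTransfer : AdjMatrix n → AdjMatrix n → Subset n → Set
IndependentRowsTransfer {n} B B' X =
  ∀ S → IndependentRows B X S → ∃ λ (S' : Subset n) → IndependentRows B' X S' × ∣ S' ∣ ≡ ∣ S ∣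

cutRank-transfer : ∀ {r} → IndependentRowsTransfer B B' X → IndependentRowsTransfer B' B X →
  CutRank B X r → CutRank B' X r
cutRank-transfer {r = r} to from ((S , S-indep , ∣S∣≡r) , maximal) =
  (let S' , S'-indep , ∣S'∣≡∣S∣ = to S S-indep in S' , S'-indep , trans ∣S'∣≡∣S∣ ∣S∣≡r) ,
  λ T T-indep → let T' , T'-indep , ∣T'∣≡∣T∣ = from T T-indep in subst (_≤ r) ∣T'∣≡∣T∣ (maximal T' T'-indep)

toggle : Fin n → Bool → Subset n → Subset n
toggle v true  T = T ⊕ ⁅ v ⁆
toggle v false T = T

toggle-· : ∀ v q (T : Subset n) f → toggle v q T · f ≡ T · f xor (q ∧ f v)
toggle-· v true  T f = ⊕⁅⁆-· T v f
toggle-· v false T f = sym (xor-identityʳ (T · f))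

toggle-⊆ : ∀ q → v ∈ S → T ⊆ S → toggle v q T ⊆ S
toggle-⊆ false v∈S T⊆S = T⊆S
toggle-⊆ true  v∈S T⊆S i∈ with ∈-⊕⁻ i∈
... | inj₁ (i∈T , _)    = T⊆S i∈T
... | inj₂ (_ , i∈⁅v⁆) = subst (_∈ _) (sym (x∈⁅y⁆⇒x≡y _ i∈⁅v⁆)) v∈S

record RowTransvection (B B' : AdjMatrix n) (X : Subset n) (v : Fin n) (a : Fin n → Bool) : Set where
  field
    pivot∈X           : v ∈ X
    pivot-coefficient : a v ≡ false
    rows              : ∀ {i c} → i ∈ X → c ∉ X → B' i c ≡ B i c xor (a i ∧ B v c)

RowTransvection-sym : ∀ {a} → RowTransvection B B' X v a → RowTransvection B' B X v a
RowTransvection-sym {B = B} {B' = B'} {X = X} {v = v} {a = a} t = record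
  { pivot∈X           = pivot∈X
  ; pivot-coefficient = pivot-coefficient
  ; rows              = λ {i} {c} i∈X c∉X →
      trans (xor-moveʳ (rows i∈X c∉X)) (cong (λ w → B' i c xor (a i ∧ w)) (sym (pivot-row c∉X)))
  }
  where
  open RowTransvection t
  pivot-row : c ∉ X → B' v c ≡ B v c
  pivot-row {c = c} c∉X = trans (rows pivot∈X c∉X)
    (trans (cong (λ α → B v c xor (α ∧ B v c)) pivot-coefficient) (xor-identityʳ (B v c)))

module _ {a : Fin n → Bool} (t : RowTransvection B B' X v a) where
  open RowTransvection t

  rowTransvection-· : T ⊆ X → c ∉ X → T · col B' c ≡ T · col B c xor (T · a ∧ B v c)
  rowTransvection-· {T = T} {c = c} T⊆X c∉X = begin
    T · col B' c                             ≡⟨ ·-cong (λ i∈T → rows (T⊆X i∈T) c∉X) ⟩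
    T · (λ i → B i c xor (a i ∧ B v c))     ≡⟨ ·-xor T (col B c) (λ i → a i ∧ B v c) ⟩
    T · col B c xor T · (λ i → a i ∧ B v c)  ≡⟨ cong (T · col B c xor_) (·-∧ʳ T a (B v c)) ⟩
    T · col B c xor (T · a ∧ B v c)          ∎
    where open ≡-Reasoning

  shift-· : T ⊆ X → c ∉ X → T · col B' c ≡ toggle v (T · a) T · col B c
  shift-· {T = T} {c = c} T⊆X c∉X = trans (rowTransvection-· T⊆X c∉X) (sym (toggle-· v (T · a) T (col B c)))

  shift-nonempty : Nonempty T → Nonempty (toggle v (T · a) T)
  shift-nonempty {T = T} T≢∅ with T · a in e
  ... | false = T≢∅
  ... | true  = ·≡true⇒Nonempty (T ⊕ ⁅ v ⁆) a
    (trans (⊕⁅⁆-· T v a) (cong₂ _xor_ e pivot-coefficient))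

  pivot-independent : IndependentRows B X S → v ∈ S → IndependentRows B' X S
  pivot-independent (S⊆X , S-indep) v∈S = S⊆X , λ T T⊆S T≢∅ →
    let c , c∉X , sum = S-indep _ (toggle-⊆ (T · a) v∈S T⊆S) (shift-nonempty T≢∅)
    in c , c∉X , trans (shift-· (⊆-trans T⊆S S⊆X) c∉X) sum

  rowTransvection-transfer : IndependentRowsTransfer B B' X
  rowTransvection-transfer S S-indep with v ∈? S
  ... | yes v∈S = S , pivot-independent S-indep v∈S , refl
  ... | no v∉S with independent-or-zeroSubset B' X S
  ...   | inj₁ S-nonzero = S , (proj₁ S-indep , S-nonzero) , refl
  ...   | inj₂ (U , U⊆S , (u , u∈U) , U-zero) =
    replace u v S ,
    pivot-independent (replace-independent S-indep pivot∈X v∉S U⊆S u∈U U+v-zero) (v∈replace S) ,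
    ∣replace∣ (U⊆S u∈U) v∉S
    where
    shifted-zero : ZeroOnCut B X (toggle v (U · a) U)
    shifted-zero = zeroOnCut λ c∉X →
      trans (sym (shift-· (⊆-trans U⊆S (proj₁ S-indep)) c∉X)) (sum≡false U-zero c∉X)

    U+v-zero : ZeroOnCut B X (U ⊕ ⁅ v ⁆)
    U+v-zero with U · a | shifted-zero
    ... | true  | toggled-zero = toggled-zero
    ... | false | toggled-zero = ⊥-elim (nonzero⇒¬zero (proj₂ S-indep U U⊆S (u , u∈U)) toggled-zero)

cutRank-rowTransvection : ∀ {a r} → RowTransvection B B' X v a → CutRank B X r → CutRank B' X r
cutRank-rowTransvection t =
  cutRank-transfer (rowTransvection-transfer t) (rowTransvection-transfer (RowTransvection-sym t))

record ColumnTransvection (B B' : AdjMatrix n) (X : Subset n) (v : Fin n) (b : Fin n → Bool) : Set where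
  field
    pivot∉X           : v ∉ X
    pivot-coefficient : b v ≡ false
    columns           : ∀ {i c} → i ∈ X → c ∉ X → B' i c ≡ B i c xor (B i v ∧ b c)

ColumnTransvection-sym : ∀ {b} → ColumnTransvection B B' X v b → ColumnTransvection B' B X v b
ColumnTransvection-sym {B = B} {B' = B'} {X = X} {v = v} {b = b} t = record
  { pivot∉X           = pivot∉X
  ; pivot-coefficient = pivot-coefficient
  ; columns           = λ {i} {c} i∈X c∉X →
      trans (xor-moveʳ (columns i∈X c∉X)) (cong (λ w → B' i c xor (w ∧ b c)) (sym (pivot-column i∈X)))
  }
  where
  open ColumnTransvection t
  pivot-column : i ∈ X → B' i v ≡ B i v
  pivot-column {i = i} i∈X = begin
    B' i v                     ≡⟨ columns i∈X pivot∉X ⟩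
    B i v xor (B i v ∧ b v)    ≡⟨ cong (λ β → B i v xor (B i v ∧ β)) pivot-coefficient ⟩
    B i v xor (B i v ∧ false)  ≡⟨ cong (B i v xor_) (∧-zeroʳ (B i v)) ⟩
    B i v xor false            ≡⟨ xor-identityʳ (B i v) ⟩
    B i v                      ∎
    where open ≡-Reasoning

module _ {b : Fin n → Bool} (t : ColumnTransvection B B' X v b) where
  open ColumnTransvection t

  columnTransvection-· : T ⊆ X → c ∉ X → T · col B' c ≡ T · col B c xor (T · col B v ∧ b c)
  columnTransvection-· {T = T} {c = c} T⊆X c∉X = begin
    T · col B' c                                 ≡⟨ ·-cong (λ i∈T → columns (T⊆X i∈T) c∉X) ⟩
    T · (λ i → B i c xor (B i v ∧ b c))         ≡⟨ ·-xor T (col B c) (λ i → B i v ∧ b c) ⟩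
    T · col B c xor T · (λ i → B i v ∧ b c)      ≡⟨ cong (T · col B c xor_) (·-∧ʳ T (col B v) (b c)) ⟩
    T · col B c xor (T · col B v ∧ b c)          ∎
    where open ≡-Reasoning

  columnTransvection-nonzero : T ⊆ X → NonzeroOnCut B X T → NonzeroOnCut B' X T
  columnTransvection-nonzero {T = T} T⊆X (c , c∉X , sum) with T · col B v in e
  ... | true  = v , pivot∉X ,
    trans (columnTransvection-· T⊆X pivot∉X) (cong₂ (λ s β → s xor (s ∧ β)) e pivot-coefficient)
  ... | false = c , c∉X ,
    trans (columnTransvection-· T⊆X c∉X) (cong₂ (λ σ s → σ xor (s ∧ b c)) sum e)

  columnTransvection-transfer : IndependentRowsTransfer B B' X
  columnTransvection-transfer S (S⊆X , S-indep) =
    S , (S⊆X , λ T T⊆S T≢∅ → columnTransvection-nonzero (⊆-trans T⊆S S⊆X) (S-indep T T⊆S T≢∅)) , refl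

cutRank-columnTransvection : ∀ {b r} → ColumnTransvection B B' X v b → CutRank B X r → CutRank B' X r
cutRank-columnTransvection t =
  cutRank-transfer (columnTransvection-transfer t) (columnTransvection-transfer (ColumnTransvection-sym t))

module _ {A : AdjMatrix n} (simple : IsSimpleGraph A) where
  private
    symmetric = proj₁ simple
    loopless  = proj₂ simple

  localComp-across-cut : i ∈ X → c ∉ X → localComp A v i c ≡ A i c xor (A v i ∧ A v c)
  localComp-across-cut {i = i} {c = c} i∈X c∉X with i ≟ c
  ... | yes refl = ⊥-elim (c∉X i∈X)
  ... | no _     = refl

  localComp-rowTransvection : v ∈ X → RowTransvection A (localComp A v) X v (A v)
  localComp-rowTransvection {v = v} v∈X = record
    { pivot∈X           = v∈X
    ; pivot-coefficient = loopless v
    ; rows              = localComp-across-cut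
    }

  localComp-columnTransvection : v ∉ X → ColumnTransvection A (localComp A v) X v (A v)
  localComp-columnTransvection {v = v} v∉X = record
    { pivot∉X           = v∉X
    ; pivot-coefficient = loopless v
    ; columns           = λ {i} {c} i∈X c∉X →
        trans (localComp-across-cut i∈X c∉X) (cong (λ w → A i c xor (w ∧ A v c)) (symmetric v i))
    }

  cutRank-localComp : ∀ {r} → CutRank A X r ⇔ CutRank (localComp A v) X r
  cutRank-localComp {X = X} {v = v} with v ∈? X
  ... | yes v∈X = let t = localComp-rowTransvection v∈X in
    mk⇔ (cutRank-rowTransvection t) (cutRank-rowTransvection (RowTransvection-sym t))
  ... | no v∉X = let t = localComp-columnTransvection v∉X in
    mk⇔ (cutRank-columnTransvection t) (cutRank-columnTransvection (ColumnTransvection-sym t))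

Equiv-map : ∀ {x y} → (∀ {X r} → CutRank B X r → CutRank B' X r) → Equiv B x y → Equiv B' x y
Equiv-map f (r , t , ρx , ρy , ρxy , t≤r) = r , t , f ρx , f ρy , f ρxy , t≤r

corollary3p2 : ∀ (n : ℕ) (A : AdjMatrix n) → IsSimpleGraph A →
    ∀ (x y v : Fin n) → Equiv A x y ⇔ Equiv (localComp A v) x y
corollary3p2 n A simple x y v = mk⇔
  (Equiv-map (Equivalence.to (cutRank-localComp simple)))
  (Equiv-map (Equivalence.from (cutRank-localComp simple)))
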